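{- Let $G=(V,E)$ be a graph whose vertex set is partitioned into modules $M_0,M_1,\ldots,M_k$ with $|M_0|=1$. If $G$ admits a HIST in which the vertex of $M_0$ is not a leaf, then $G$ admits a HIST $T$ such that for each $i=1,\ldots,k$ one of the following holds: 1. every vertex of $M_i$ is a leaf of $T$, i.e., $d_T(v)=1$ for all $v\in M_i$; 2. there exists $u\in M_i$ with $d_T(u)\ge 3$ such that $d_T(v)=1$ for all $v\in M_i\setminus\{u\}$, and moreover either (a) $d_T(u)=3$ and the degree of $u$ in $T[M_i]$ is $1$, or (b) $d_T(u)\ge 3$ and the degree of $u$ in $T[M_i]$ is $0$.
   Context: All graphs are finite, simple and undirected. A HIST (homeomorphically irreducible spanning tree) of a connected graph $G$ is a spanning tree of $G$ with no vertex of degree exactly $2$ in the tree. A module of $G$ is a vertex set $M$ such that every vertex outside $M$ is either adjacent to all vertices of $M$ or to none of them. $d_T(v)$ denotes the degree of $v$ in the tree $T$, and $T[M_i]$ denotes the subgraph of $T$ induced by $M_i$. -}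

module Defs where

open import Data.Nat using (ℕ; zero; suc; _+_; _≥_; _≤_)
open import Data.Bool using (Bool; true; false; T; _∧_; if_then_else_)
open import Data.Fin using (Fin; zero; suc; _≟_)
open import Data.List using (List; []; _∷_; length; _∷ʳ_)
open import Data.List.Relation.Unary.Linked using (Linked)
open import Data.List.Relation.Unary.Unique.Propositional using (Unique)
open import Data.Product using (Σ; ∃; _×_; _,_)
open import Relation.Nullary using (¬_)
open import Relation.Nullary.Decidable using (⌊_⌋)
open import Relation.Binary.PropositionalEquality using (_≡_; _≢_)
open import Relation.Binary.Construct.Closure.ReflexiveTransitive using (Star)

record Graph (n : ℕ) : Set where
  field
    adj   : Fin n → Fin n → Bool
    sym   : ∀ u v → adj u v ≡ adj v u
    irrefl : ∀ v → adj v v ≡ false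
open Graph public

countTrue : ∀ {n} → (Fin n → Bool) → ℕ
countTrue {zero} f = 0
countTrue {suc n} f = (if f zero then 1 else 0) + countTrue (λ v → f (suc v))

EdgeSet : ℕ → Set
EdgeSet n = Fin n → Fin n → Bool

Adj : ∀ {n} → EdgeSet n → Fin n → Fin n → Set
Adj t u v = T (t u v)

deg : ∀ {n} → EdgeSet n → Fin n → ℕ
deg t u = countTrue (λ v → t u v)

Connected : ∀ {n} → EdgeSet n → Set
Connected t = ∀ u v → Star (Adj t) u v

HasCycle : ∀ {n} → EdgeSet n → Set
HasCycle t = Σ _ λ x → Σ (List _) λ ys →
  (length ys ≥ 2) × Unique (x ∷ ys) × Linked (Adj t) ((x ∷ ys) ∷ʳ x)

record SpanningTree {n : ℕ} (G : Graph n) (t : EdgeSet n) : Set where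
  field
    sub    : ∀ u v → T (t u v) → T (adj G u v)
    tsym   : ∀ u v → t u v ≡ t v u
    tirr   : ∀ v → t v v ≡ false
    conn   : Connected t
    acyc   : ¬ HasCycle t

record HIST {n : ℕ} (G : Graph n) (t : EdgeSet n) : Set where
  field
    tree  : SpanningTree G t
    no2   : ∀ v → deg t v ≢ 2

IsModule : ∀ {n} → Graph n → (Fin n → Set) → Set
IsModule G M = ∀ x → ¬ M x → ∀ y z → M y → M z → adj G x y ≡ adj G x z

-- Partition of V into M₀, …, M_k given by p : V → Fin (suc k), M_i = p⁻¹(i).
InPart : ∀ {n k} → (Fin n → Fin (suc k)) → Fin (suc k) → Fin n → Set
InPart p i v = p v ≡ i

degIn : ∀ {n k} → EdgeSet n → (Fin n → Fin (suc k)) → Fin (suc k) → Fin n → ℕ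
degIn t p i u = countTrue (λ v → t u v ∧ ⌊ p v ≟ i ⌋)

GoodPart : ∀ {n k} → EdgeSet n → (Fin n → Fin (suc k)) → Fin (suc k) → Set
GoodPart t p i =
  (∀ v → InPart p i v → deg t v ≡ 1)
  ⊎' (Σ _ λ u → InPart p i u × deg t u ≥ 3 ×
       (∀ v → InPart p i v → v ≢ u → deg t v ≡ 1) ×
       ((deg t u ≡ 3 × degIn t p i u ≡ 1) ⊎' (deg t u ≥ 3 × degIn t p i u ≡ 0)))
  where
  open import Data.Sum using () renaming (_⊎_ to _⊎'_)

-- Root the given HIST at r by breadth-first search. Being acyclic, it is then exactly the tree
-- of parent edges, so no vertex other than r has exactly one child, and r has none or at least
-- three. In every module M_u let R_u be an internal vertex of least depth. Since the vertices
-- of a module have the same neighbours outside it, every vertex x ≠ r can be re-hung on a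
-- representative: on R_w when the parent of x lies in another module M_w, and otherwise (x and
-- its parent both in M_u) on the representative of the module containing the parent of R_u,
-- except that one chosen child of R_u inside M_u may stay on R_u. Only representatives then
-- have children, so all other vertices are leaves, and R_u has its parent, the vertices re-hung
-- on it from elsewhere and possibly its chosen child, while r keeps all its children. Keeping
-- the chosen child exactly when one vertex comes from elsewhere gives R_u degree 1, or 3 with
-- one neighbour in M_u, or at least 3 with none. The choice made for M_u changes only the count
-- at a strictly shallower representative, so all choices are determined by a well-founded fixed
-- point; ordering the representatives by depth shows that the new parents form a spanning tree.
module Submission where

open import Defs hiding (sym)
open import Data.Nat using (ℕ) renaming (suc to 1+)
open import Data.Fin using (Fin; zero; suc)
open import Data.Product using (Σ; _×_)
open import Relation.Binary.PropositionalEquality using (_≡_; _≢_)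

open import Data.Bool using (Bool; false; T; _∧_; if_then_else_)
open import Data.Empty using (⊥; ⊥-elim)
open import Data.Fin using (_≟_)
open import Data.Fin.Properties using (any?; 0≢1+n; suc-injective)
open import Data.List using (List; []; _∷_; _∷ʳ_; length; filter; upTo; allFin; map)
open import Data.List.Extrema.Nat using (argmin; argmin-all; f[argmin]≤f[xs]; f[argmin]≤f[⊤]; max; xs≤max)
open import Data.List.Membership.Propositional.Properties using (∈-filter⁺; ∈-allFin; ∈-upTo⁺; ∈-map⁺)
open import Data.List.Properties using (length-++)
open import Data.List.Relation.Unary.All as All using (All; []; _∷_; lookup)
open import Data.List.Relation.Unary.All.Properties using (all-filter; ∷ʳ⁺; ∷ʳ⁻)
open import Data.List.Relation.Unary.Linked as Linked using (Linked; []; [-]; _∷_)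
open import Data.List.Relation.Unary.Linked.Properties using (Linked⇒All)
open import Data.List.Relation.Unary.Unique.Propositional using (Unique; []; _∷_)
open import Data.Nat using (zero; suc; pred; _+_; _≤_; _<_; _∸_; z≤n; s≤s; s≤s⁻¹; _≤?_)
open import Data.Nat.Induction using (<-wellFounded)
open import Data.Nat.Properties
  using (+-suc; ≤-trans; ≤-reflexive; m≤n⇒m≤1+n; <-trans; <-irrefl; <-asym; ≤-<-trans; <-≤-trans; ≰⇒>;
         <⇒≤; n<1+n; +-monoˡ-<; +-monoʳ-<; m≤n+m; m∸n≤m; ∸-monoʳ-<; m<n⇒0<n∸m)
  renaming (_≟_ to _≟ℕ_)
open import Data.Product using (∃; ∃-syntax; _,_; proj₁; proj₂)
import Data.Product as Product
open import Data.Sum using (_⊎_; inj₁; inj₂; [_,_]′)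
import Data.Sum as Sum
open import Data.Unit using (⊤; tt)
open import Function using (_⇔_; mk⇔; Equivalence; _∘_; id; flip)
open import Induction.WellFounded using (Acc; acc)
open import Level using (0ℓ)
open import Relation.Binary using (Rel)
open import Relation.Binary.Construct.Closure.ReflexiveTransitive as Star using (Star; ε; _◅_; _◅◅_)
open import Relation.Binary.PropositionalEquality using (refl; sym; trans; cong; cong₂; subst; module ≡-Reasoning)
open import Relation.Nullary using (¬_; Dec; yes; no; does)
import Relation.Nullary.Decidable as Dec
open import Relation.Nullary.Decidable using (¬?; _×-dec_; _⊎-dec_; dec-false; does-⇔; isYes≗does; T?)
open import Relation.Unary using (Pred; Decidable)

-- Counting vertices

private
  variable
    n : ℕ
    P Q : Pred (Fin n) 0ℓ

T-does : ∀ {A : Set} (A? : Dec A) → T (does A?) ⇔ A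
T-does (yes a) = mk⇔ (λ _ → a) _
T-does (no ¬a) = mk⇔ (λ ()) ¬a

count : Decidable P → ℕ
count P? = countTrue (λ x → does (P? x))

countTrue-cong : {f g : Fin n → Bool} → (∀ x → f x ≡ g x) → countTrue f ≡ countTrue g
countTrue-cong {zero}  eq = refl
countTrue-cong {suc n} eq rewrite eq zero = cong (_ +_) (countTrue-cong (eq ∘ suc))

count-cong : (P? : Decidable P) (Q? : Decidable Q) → (∀ x → P x ⇔ Q x) → count P? ≡ count Q?
count-cong P? Q? P⇔Q = countTrue-cong (λ x → does-⇔ (P⇔Q x) (P? x) (Q? x))

count-⊎ : (P? : Decidable P) (Q? : Decidable Q) → (∀ x → P x → ¬ Q x) →
          count (λ x → P? x ⊎-dec Q? x) ≡ count P? + count Q?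
count-⊎ {zero}  P? Q? disj = refl
count-⊎ {suc n} P? Q? disj with P? zero | Q? zero
... | yes p | yes q = ⊥-elim (disj zero p q)
... | yes _ | no _  = cong suc (count-⊎ (P? ∘ suc) (Q? ∘ suc) (disj ∘ suc))
... | no _  | yes _ = trans (cong suc (count-⊎ (P? ∘ suc) (Q? ∘ suc) (disj ∘ suc))) (sym (+-suc _ _))
... | no _  | no _  = count-⊎ (P? ∘ suc) (Q? ∘ suc) (disj ∘ suc)

count-split : (P? : Decidable P) (Q? : Decidable Q) →
              count P? ≡ count (λ x → P? x ×-dec Q? x) + count (λ x → P? x ×-dec ¬? (Q? x))
count-split {P = P} {Q = Q} P? Q? =
  trans (count-cong P? (λ x → (P? x ×-dec Q? x) ⊎-dec (P? x ×-dec ¬? (Q? x))) split)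
        (count-⊎ (λ x → P? x ×-dec Q? x) (λ x → P? x ×-dec ¬? (Q? x)) λ _ (_ , q) (_ , ¬q) → ¬q q)
  where
  split : ∀ x → P x ⇔ ((P x × Q x) ⊎ (P x × ¬ Q x))
  split x = mk⇔ (λ px → Sum.map (px ,_) (px ,_) (Dec.toSum (Q? x))) [ proj₁ , proj₁ ]′

count-mono : (P? : Decidable P) (Q? : Decidable Q) → (∀ x → P x → Q x) → count P? ≤ count Q?
count-mono {zero}  P? Q? P⊆Q = z≤n
count-mono {suc n} P? Q? P⊆Q with P? zero | Q? zero
... | yes _ | yes _ = s≤s (count-mono (P? ∘ suc) (Q? ∘ suc) (P⊆Q ∘ suc))
... | yes p | no ¬q = ⊥-elim (¬q (P⊆Q zero p))
... | no _  | yes _ = m≤n⇒m≤1+n (count-mono (P? ∘ suc) (Q? ∘ suc) (P⊆Q ∘ suc))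
... | no _  | no _  = count-mono (P? ∘ suc) (Q? ∘ suc) (P⊆Q ∘ suc)

count-none : (P? : Decidable P) → (∀ x → ¬ P x) → count P? ≡ 0
count-none {zero}  P? none = refl
count-none {suc n} P? none with P? zero
... | yes p = ⊥-elim (none zero p)
... | no _  = count-none (P? ∘ suc) (none ∘ suc)

count-unique : (P? : Decidable P) (a : Fin n) → P a → (∀ x → P x → x ≡ a) → count P? ≡ 1
count-unique {suc n} P? zero pa uniq with P? zero
... | yes _ = cong suc (count-none (P? ∘ suc) λ x px → 0≢1+n (sym (uniq (suc x) px)))
... | no ¬p = ⊥-elim (¬p pa)
count-unique {suc n} P? (suc a) pa uniq with P? zero
... | yes p = ⊥-elim (0≢1+n (uniq zero p))
... | no _  = count-unique (P? ∘ suc) a pa λ x px → suc-injective (uniq (suc x) px)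

count-witness : (P? : Decidable P) → 0 < count P? → ∃ P
count-witness {suc n} P? pos with P? zero
... | yes p = zero , p
... | no _  = let (x , px) = count-witness (P? ∘ suc) pos in suc x , px

count-positive : (P? : Decidable P) (a : Fin n) → P a → 0 < count P?
count-positive P? zero pa with P? zero
... | yes _ = s≤s z≤n
... | no ¬p = ⊥-elim (¬p pa)
count-positive P? (suc a) pa with P? zero
... | yes _ = s≤s z≤n
... | no _  = count-positive (P? ∘ suc) a pa

-- Choices, minimisers and fixed points

choice : ∀ {A : Set} {P : Pred A 0ℓ} → A → Dec (∃ P) → A
choice a (yes (x , _)) = x
choice a (no _)        = a

choice-satisfies : ∀ {A : Set} {P : Pred A 0ℓ} (a : A) (P∃? : Dec (∃ P)) → ∃ P → P (choice a P∃?)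
choice-satisfies a (yes (_ , px)) _  = px
choice-satisfies a (no ¬∃)        ∃P = ⊥-elim (¬∃ ∃P)

module _ {n : ℕ} {P : Pred (Fin n) 0ℓ} (P? : Decidable P) (w : Fin n → ℕ) where

  private
    candidates : List (Fin n)
    candidates = filter P? (allFin n)

    argmin-from : ∀ y → P y → P (argmin w y candidates) × (∀ z → P z → w (argmin w y candidates) ≤ w z)
    argmin-from y py =
      argmin-all w py (all-filter P? (allFin n)) ,
      λ z pz → lookup (f[argmin]≤f[xs] {f = w} y candidates) (∈-filter⁺ P? (∈-allFin z) pz)

  argminOr : Fin n → Fin n
  argminOr d with any? P?
  ... | yes (y , _) = argmin w y candidates
  ... | no _        = d

  argminOr-minimal : ∀ d y → P y → P (argminOr d) × w (argminOr d) ≤ w y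
  argminOr-minimal d y py with any? P?
  ... | yes (y′ , py′) = let (pm , min) = argmin-from y′ py′ in pm , min y py
  ... | no ¬∃          = ⊥-elim (¬∃ (y , py))

  argminOr-cases : ∀ d → P (argminOr d) ⊎ argminOr d ≡ d
  argminOr-cases d with any? P?
  ... | yes (y , py) = inj₁ (proj₁ (argmin-from y py))
  ... | no _         = inj₂ refl

module _ {P : Pred ℕ 0ℓ} (P? : Decidable P) where

  leastUpTo : ℕ → ℕ
  leastUpTo b = argmin id b (filter P? (upTo b))

  leastUpTo-satisfies : ∀ {b} → P b → P (leastUpTo b)
  leastUpTo-satisfies {b} pb = argmin-all id pb (all-filter P? (upTo b))

  leastUpTo-least : ∀ {b k} → P k → leastUpTo b ≤ k
  leastUpTo-least {b} {k} pk with b ≤? k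
  ... | yes b≤k = ≤-trans (f[argmin]≤f[⊤] {f = id} b (filter P? (upTo b))) b≤k
  ... | no b≰k  = lookup (f[argmin]≤f[xs] {f = id} b (filter P? (upTo b)))
                         (∈-filter⁺ P? (∈-upTo⁺ (≰⇒> b≰k)) pk)

module _ {m : ℕ} {B : Set} (F : (Fin m → B) → Fin m → B) (h : Fin m → ℕ)
         (F-local : ∀ f g a → (∀ b → h a < h b → f b ≡ g b) → F f a ≡ F g a) (init : Fin m → B) where

  private
    H : ℕ
    H = suc (max 0 (map h (allFin m)))

    h<H : ∀ a → h a < H
    h<H a = s≤s (lookup (xs≤max 0 (map h (allFin m))) (∈-map⁺ h (∈-allFin a)))

    approx : ℕ → Fin m → B
    approx zero    = init
    approx (suc s) = F (approx s)

    approx-stable : ∀ s a → H ∸ h a ≤ s → approx s a ≡ approx (suc s) a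
    approx-stable zero    a H∸ha≤0   = ⊥-elim (<-irrefl refl (<-≤-trans (m<n⇒0<n∸m (h<H a)) H∸ha≤0))
    approx-stable (suc s) a H∸ha≤1+s = F-local (approx s) (approx (suc s)) a λ b ha<hb →
      approx-stable s b (s≤s⁻¹ (≤-trans (∸-monoʳ-< ha<hb (<⇒≤ (h<H b))) H∸ha≤1+s))

  fixpoint : Fin m → B
  fixpoint = approx H

  fixpoint-unfold : ∀ a → fixpoint a ≡ F fixpoint a
  fixpoint-unfold a = approx-stable H a (m∸n≤m H (h a))

-- Walks and cycles

data Walk {A : Set} (R : Rel A 0ℓ) : A → A → List A → Set where
  []  : ∀ {a} → Walk R a a []
  _∷_ : ∀ {a b c L} → R a b → Walk R b c L → Walk R a c (b ∷ L)

module _ {A : Set} {R : Rel A 0ℓ} where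

  walk-snoc : ∀ {a b c L} → Walk R a b L → R b c → Walk R a c (L ∷ʳ c)
  walk-snoc []        bc = bc ∷ []
  walk-snoc (ab ∷ bL) bc = ab ∷ walk-snoc bL bc

  walk-close : ∀ {a b c L} → Walk R a b L → R b c → Linked R (a ∷ L ∷ʳ c)
  walk-close []        bc = bc ∷ [-]
  walk-close (ab ∷ bL) bc = ab ∷ walk-close bL bc

  linked-snoc : ∀ {a b c} M → Linked R (a ∷ M ∷ʳ b) → R b c → Linked R (a ∷ M ∷ʳ b ∷ʳ c)
  linked-snoc []      (ab ∷ [-]) bc = ab ∷ bc ∷ [-]
  linked-snoc (m ∷ M) (am ∷ lk)  bc = am ∷ linked-snoc M lk bc

walk-map : ∀ {A : Set} {R S : Rel A 0ℓ} {a b L} → (∀ {x y} → R x y → S x y) → Walk R a b L → Walk S a b L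
walk-map f []       = []
walk-map f (r ∷ rs) = f r ∷ walk-map f rs

module _ {A : Set} where

  unique-∷ʳ : ∀ {y : A} {xs} → Unique xs → All (_≢ y) xs → Unique (xs ∷ʳ y)
  unique-∷ʳ []       []         = [] ∷ []
  unique-∷ʳ (x∉ ∷ u) (x≢y ∷ ≢y) = ∷ʳ⁺ x∉ x≢y ∷ unique-∷ʳ u ≢y

  unique-snoc : ∀ {x : A} {xs} → Unique (x ∷ xs) → Unique (xs ∷ʳ x)
  unique-snoc (x∉ ∷ u) = unique-∷ʳ u (All.map (λ x≢z z≡x → x≢z (sym z≡x)) x∉)

  NoBacktrack : List A → Set
  NoBacktrack (a ∷ b ∷ c ∷ L) = a ≢ c × NoBacktrack (b ∷ c ∷ L)
  NoBacktrack _               = ⊤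

  unique⇒noBacktrack : ∀ {L} → Unique L → NoBacktrack L
  unique⇒noBacktrack {[]}            _                   = tt
  unique⇒noBacktrack {_ ∷ []}        _                   = tt
  unique⇒noBacktrack {_ ∷ _ ∷ []}    _                   = tt
  unique⇒noBacktrack {_ ∷ _ ∷ _ ∷ _} ((_ ∷ a≢c ∷ _) ∷ u) = a≢c , unique⇒noBacktrack u

  cycle-noBacktrack : ∀ {x y₁ y₂ : A} {ys} →
                      Unique (x ∷ y₁ ∷ y₂ ∷ ys) → NoBacktrack (x ∷ y₁ ∷ y₂ ∷ ys ∷ʳ x)
  cycle-noBacktrack u@((_ ∷ x≢y₂ ∷ _) ∷ _) = x≢y₂ , unique⇒noBacktrack (unique-snoc u)

-- Trees given by parent functions

record Rooting {n : ℕ} (r : Fin n) : Set where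
  field
    parent      : Fin n → Fin n
    rank        : Fin n → ℕ
    rank-parent : ∀ v → v ≢ r → rank (parent v) < rank v

module ParentTree {n : ℕ} {r : Fin n} (R : Rooting r) where

  open Rooting R

  ChildOf : Fin n → Fin n → Set
  ChildOf x y = x ≢ r × parent x ≡ y

  childOf? : ∀ x y → Dec (ChildOf x y)
  childOf? x y = ¬? (x ≟ r) ×-dec (parent x ≟ y)

  Link : Fin n → Fin n → Set
  Link u v = ChildOf u v ⊎ ChildOf v u

  link? : ∀ u v → Dec (Link u v)
  link? u v = childOf? u v ⊎-dec childOf? v u

  tree : EdgeSet n
  tree u v = does (link? u v)

  Adj-tree : ∀ {u v} → Adj tree u v ⇔ Link u v
  Adj-tree {u} {v} = T-does (link? u v)

  children : Fin n → ℕ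
  children y = count (λ x → childOf? x y)

  rank-child : ∀ {x y} → ChildOf x y → rank y < rank x
  rank-child (x≢r , refl) = rank-parent _ x≢r

  child-asym : ∀ {x y} → ChildOf x y → ¬ ChildOf y x
  child-asym xy yx = <-asym (rank-child xy) (rank-child yx)

  parent-induction : (P : Pred (Fin n) 0ℓ) → P r → (∀ v → v ≢ r → P (parent v) → P v) → ∀ v → P v
  parent-induction P Pr step v = go v (<-wellFounded (rank v))
    where
    go : ∀ v → Acc _<_ (rank v) → P v
    go v (acc rec) with v ≟ r
    ... | yes refl = Pr
    ... | no v≢r   = step v v≢r (go (parent v) (rec (rank-parent v v≢r)))

  rank-root-least : ∀ v → v ≢ r → rank r < rank v
  rank-root-least = parent-induction (λ v → v ≢ r → rank r < rank v) (λ r≢r → ⊥-elim (r≢r refl)) step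
    where
    step : ∀ v → v ≢ r → (parent v ≢ r → rank r < rank (parent v)) → v ≢ r → rank r < rank v
    step v v≢r ih _ with parent v ≟ r
    ... | yes pv≡r = subst (λ z → rank z < rank v) pv≡r (rank-parent v v≢r)
    ... | no pv≢r  = <-trans (ih pv≢r) (rank-parent v v≢r)

  root-has-child : ∀ v → v ≢ r → ∃[ x ] ChildOf x r
  root-has-child = parent-induction (λ v → v ≢ r → ∃[ x ] ChildOf x r) (λ r≢r → ⊥-elim (r≢r refl)) step
    where
    step : ∀ v → v ≢ r → (parent v ≢ r → ∃[ x ] ChildOf x r) → v ≢ r → ∃[ x ] ChildOf x r
    step v v≢r ih _ with parent v ≟ r
    ... | yes pv≡r = v , v≢r , pv≡r
    ... | no pv≢r  = ih pv≢r

  tree-sym : ∀ u v → tree u v ≡ tree v u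
  tree-sym u v = does-⇔ (mk⇔ [ inj₂ , inj₁ ]′ [ inj₂ , inj₁ ]′) (link? u v) (link? v u)

  tree-irrefl : ∀ v → tree v v ≡ false
  tree-irrefl v = dec-false (link? v v) [ (λ vv → child-asym vv vv) , (λ vv → child-asym vv vv) ]′

  to-root : ∀ v → Star (Adj tree) v r
  to-root = parent-induction (λ v → Star (Adj tree) v r) ε
              λ v v≢r p→r → Equivalence.from Adj-tree (inj₁ (v≢r , refl)) ◅ p→r

  tree-connected : Connected tree
  tree-connected u v = to-root u ◅◅ Star.reverse (λ {a} {b} → subst T (tree-sym a b)) (to-root v)

  descend : ∀ {a b L} → Linked Link (a ∷ b ∷ L) → NoBacktrack (a ∷ b ∷ L) → ChildOf b a →
            Linked (flip ChildOf) (a ∷ b ∷ L)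
  descend {L = []}    _                  _          b↓ = b↓ ∷ [-]
  descend {L = c ∷ L} (_ ∷ inj₁ b↑ ∷ lk) (a≢c , _)  b↓ = ⊥-elim (a≢c (trans (sym (proj₂ b↓)) (proj₂ b↑)))
  descend {L = c ∷ L} (_ ∷ inj₂ c↓ ∷ lk) (_ , noBt) b↓ = b↓ ∷ descend (inj₂ c↓ ∷ lk) noBt c↓

  -- A cycle starting with a downward step keeps going down, so the rank increases all the way
  -- round; one starting upwards is rotated to start at the parent, which has smaller rank.
  no-cycle : ∀ x ys → Acc _<_ (rank x) → 2 ≤ length ys → Unique (x ∷ ys) →
             Linked Link (x ∷ ys ∷ʳ x) → ⊥
  no-cycle x (_ ∷ []) _ (s≤s ()) _ _
  no-cycle x (y₁ ∷ y₂ ∷ ys) _ _ u lk@(inj₂ y₁↓ ∷ _)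
    with Linked.map rank-child (descend lk (cycle-noBacktrack u) y₁↓)
  ... | x<y₁ ∷ ranks = <-irrefl refl (proj₂ (∷ʳ⁻ {xs = y₁ ∷ y₂ ∷ ys} (Linked⇒All <-trans x<y₁ ranks)))
  no-cycle x (y₁ ∷ y₂ ∷ ys) (acc rec) _ u (inj₁ x↑ ∷ lk) =
    no-cycle y₁ (y₂ ∷ ys ∷ʳ x) (rec (rank-child x↑)) 2≤length
             (unique-snoc u) (linked-snoc (y₂ ∷ ys) lk (inj₁ x↑))
    where
    2≤length = s≤s (subst (1 ≤_) (sym (length-++ ys)) (m≤n+m 1 (length ys)))

  tree-acyclic : ¬ HasCycle tree
  tree-acyclic (x , ys , 2≤∣ys∣ , u , lk) =
    no-cycle x ys (<-wellFounded (rank x)) 2≤∣ys∣ u (Linked.map (Equivalence.to Adj-tree) lk)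

  tree-spanning : ∀ (G : Graph n) → (∀ x → x ≢ r → T (adj G x (parent x))) → SpanningTree G tree
  tree-spanning G parent-adj = record
    { sub  = λ u v uv → [ child-adj , down-adj ]′ (Equivalence.to Adj-tree uv)
    ; tsym = tree-sym
    ; tirr = tree-irrefl
    ; conn = tree-connected
    ; acyc = tree-acyclic
    }
    where
    child-adj : ∀ {x y} → ChildOf x y → T (adj G x y)
    child-adj (x≢r , refl) = parent-adj _ x≢r
    down-adj : ∀ {x y} → ChildOf y x → T (adj G x y)
    down-adj {x} {y} y↑ = subst T (Graph.sym G y x) (child-adj y↑)

  deg-tree : ∀ v → deg tree v ≡ count (childOf? v) + children v
  deg-tree v = count-⊎ (childOf? v) (λ u → childOf? u v) λ u v↑ u↑ → child-asym v↑ u↑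

  deg-tree-root : deg tree r ≡ children r
  deg-tree-root = trans (deg-tree r) (cong (_+ children r) (count-none (childOf? r) λ _ (r≢r , _) → r≢r refl))

  deg-tree-nonroot : ∀ v → v ≢ r → deg tree v ≡ suc (children v)
  deg-tree-nonroot v v≢r =
    trans (deg-tree v) (cong (_+ children v) (count-unique (childOf? v) (parent v) (v≢r , refl) λ _ → sym ∘ proj₂))

  degIn-tree : ∀ {k} (p : Fin n → Fin (suc k)) i y → p (parent y) ≢ i →
               degIn tree p i y ≡ count (λ x → childOf? x y ×-dec (p x ≟ i))
  degIn-tree p i y p[py]≢i = begin
    degIn tree p i y
      ≡⟨ countTrue-cong (λ v → cong (does (link? y v) ∧_) (isYes≗does (p v ≟ i))) ⟩
    count (λ v → link? y v ×-dec (p v ≟ i))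
      ≡⟨ count-cong (λ v → link? y v ×-dec (p v ≟ i)) (λ v → up? v ⊎-dec down? v)
                    (λ _ → mk⇔ distrib undistrib) ⟩
    count (λ v → up? v ⊎-dec down? v)
      ≡⟨ count-⊎ up? down? (λ _ (y↑ , _) (v↑ , _) → child-asym y↑ v↑) ⟩
    count up? + count down?
      ≡⟨ cong (_+ count down?) (count-none up? λ { _ ((_ , refl) , pv≡i) → p[py]≢i pv≡i }) ⟩
    count down? ∎
    where
    open ≡-Reasoning
    up? : ∀ v → Dec (ChildOf y v × p v ≡ i)
    up? v = childOf? y v ×-dec (p v ≟ i)
    down? : ∀ v → Dec (ChildOf v y × p v ≡ i)
    down? v = childOf? v y ×-dec (p v ≟ i)
    distrib : ∀ {A B C : Set} → (A ⊎ B) × C → (A × C) ⊎ (B × C)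
    distrib (inj₁ a , c) = inj₁ (a , c)
    distrib (inj₂ b , c) = inj₂ (b , c)
    undistrib : ∀ {A B C : Set} → (A × C) ⊎ (B × C) → (A ⊎ B) × C
    undistrib = [ Product.map₁ inj₁ , Product.map₁ inj₂ ]′

  -- The path climbs from the endpoint of larger rank; every later vertex is b or lies strictly
  -- below a or b in rank, which keeps the path free of repetitions.
  private
    Near : Fin n → Fin n → Fin n → Set
    Near a b z = z ≡ b ⊎ rank z < rank a ⊎ rank z < rank b

    NearPath : Fin n → Fin n → Set
    NearPath a b = ∃[ L ] Walk Link a b L × Unique (a ∷ L) × All (Near a b) L

    rank-≢ : ∀ {a z} → rank z < rank a → a ≢ z
    rank-≢ lt refl = <-irrefl refl lt

    higher-nonroot : ∀ {a b} → a ≢ b → rank b ≤ rank a → a ≢ r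
    higher-nonroot {b = b} a≢b b≤a refl = <-irrefl refl (<-≤-trans (rank-root-least b (a≢b ∘ sym)) b≤a)

    path-up : ∀ {a b} → a ≢ b → rank b ≤ rank a → NearPath (parent a) b → NearPath a b
    path-up {a} {b} a≢b b≤a (L , W , U , N) =
      parent a ∷ L , inj₁ (a≢r , refl) ∷ W , (rank-≢ a>pa ∷ All.map a∉ N) ∷ U ,
      inj₂ (inj₁ a>pa) ∷ All.map widen N
      where
      a≢r = higher-nonroot a≢b b≤a
      a>pa = rank-parent a a≢r
      a∉ : ∀ {z} → Near (parent a) b z → a ≢ z
      a∉ (inj₁ refl)        = a≢b
      a∉ (inj₂ (inj₁ z<pa)) = rank-≢ (<-trans z<pa a>pa)
      a∉ (inj₂ (inj₂ z<b))  = rank-≢ (<-≤-trans z<b b≤a)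
      widen : ∀ {z} → Near (parent a) b z → Near a b z
      widen (inj₁ z≡b)         = inj₁ z≡b
      widen (inj₂ (inj₁ z<pa)) = inj₂ (inj₁ (<-trans z<pa a>pa))
      widen (inj₂ (inj₂ z<b))  = inj₂ (inj₂ z<b)

    path-down : ∀ {a b} → a ≢ b → rank a < rank b → NearPath a (parent b) → NearPath a b
    path-down {a} {b} a≢b a<b (L , W , U , N) =
      L ∷ʳ b , walk-snoc W (inj₂ (b≢r , refl)) , unique-∷ʳ U (a≢b ∷ All.map ∉b N) ,
      ∷ʳ⁺ (All.map widen N) (inj₁ refl)
      where
      b≢r = higher-nonroot (a≢b ∘ sym) (<⇒≤ a<b)
      b>pb = rank-parent b b≢r
      ∉b : ∀ {z} → Near a (parent b) z → z ≢ b
      ∉b (inj₁ refl)        = rank-≢ b>pb ∘ sym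
      ∉b (inj₂ (inj₁ z<a))  = rank-≢ (<-trans z<a a<b) ∘ sym
      ∉b (inj₂ (inj₂ z<pb)) = rank-≢ (<-trans z<pb b>pb) ∘ sym
      widen : ∀ {z} → Near a (parent b) z → Near a b z
      widen (inj₁ refl)        = inj₂ (inj₂ b>pb)
      widen (inj₂ (inj₁ z<a))  = inj₂ (inj₁ z<a)
      widen (inj₂ (inj₂ z<pb)) = inj₂ (inj₂ (<-trans z<pb b>pb))

  tree-path : ∀ a b → ∃[ L ] Walk Link a b L × Unique (a ∷ L)
  tree-path a b = let (L , W , U , _) = go a b (<-wellFounded (rank a + rank b)) in L , W , U
    where
    go : ∀ a b → Acc _<_ (rank a + rank b) → NearPath a b
    go a b (acc rec) with a ≟ b | rank b ≤? rank a
    ... | yes refl | _       = [] , [] , [] ∷ [] , []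
    ... | no a≢b   | yes b≤a = path-up a≢b b≤a (go (parent a) b (rec (+-monoˡ-< (rank b) a>pa)))
      where a>pa = rank-parent a (higher-nonroot a≢b b≤a)
    ... | no a≢b   | no b≰a  = path-down a≢b a<b (go a (parent b) (rec (+-monoʳ-< (rank a) b>pb)))
      where
      a<b = ≰⇒> b≰a
      b>pb = rank-parent b (higher-nonroot (a≢b ∘ sym) (<⇒≤ a<b))

  spanning-tree-links : ∀ {G t} → SpanningTree G t → (∀ x → x ≢ r → Adj t x (parent x)) →
                        ∀ u v → Adj t u v ⇔ Link u v
  spanning-tree-links {t = t} st parent-edge u v = mk⇔ (links u v) [ up-edge , down-edge ]′
    where
    open SpanningTree st
    up-edge : ∀ {x y} → ChildOf x y → Adj t x y
    up-edge (x≢r , refl) = parent-edge _ x≢r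
    down-edge : ∀ {x y} → ChildOf y x → Adj t x y
    down-edge {x} {y} y↑ = subst T (tsym y x) (up-edge y↑)
    links : ∀ u v → Adj t u v → Link u v
    links u v uv with tree-path u v
    ... | [] , [] , _ = ⊥-elim (subst T (tirr u) uv)
    ... | _ ∷ [] , uv′ ∷ [] , _ = uv′
    ... | w₁ ∷ w₂ ∷ L , W , U = ⊥-elim (acyc (u , w₁ ∷ w₂ ∷ L , s≤s (s≤s z≤n) , U , cycle))
      where cycle = walk-close (walk-map [ up-edge , down-edge ]′ W) (subst T (tsym u v) uv)

  deg-spanning-tree : ∀ {G t} → SpanningTree G t → (∀ x → x ≢ r → Adj t x (parent x)) →
                      ∀ v → deg t v ≡ deg tree v
  deg-spanning-tree {t = t} st parent-edge v =
    count-cong (λ u → T? (t v u)) (link? v) (spanning-tree-links st parent-edge v)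

-- Breadth-first rooting

module BreadthFirst {n : ℕ} (t : EdgeSet n) (r : Fin n) (reachable : ∀ v → Star (Adj t) r v) where

  Reach : ℕ → Fin n → Set
  Reach zero    v = v ≡ r
  Reach (suc k) v = Reach k v ⊎ ∃[ u ] Adj t u v × Reach k u

  reach? : ∀ k v → Dec (Reach k v)
  reach? zero    v = v ≟ r
  reach? (suc k) v = reach? k v ⊎-dec any? (λ u → T? (t u v) ×-dec reach? k u)

  reach-along : ∀ {a v k} → Star (Adj t) a v → Reach k a → ∃[ m ] Reach m v
  reach-along ε       ra = _ , ra
  reach-along (e ◅ s) ra = reach-along s (inj₂ (_ , e , ra))

  reached : ∀ v → ∃[ k ] Reach k v
  reached v = reach-along (reachable v) refl

  depth : Fin n → ℕ
  depth v = leastUpTo (λ k → reach? k v) (proj₁ (reached v))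

  depth-reach : ∀ v → Reach (depth v) v
  depth-reach v = leastUpTo-satisfies (λ k → reach? k v) (proj₂ (reached v))

  depth-least : ∀ {k} v → Reach k v → depth v ≤ k
  depth-least v = leastUpTo-least (λ k → reach? k v) {proj₁ (reached v)}

  parent : Fin n → Fin n
  parent v = choice r (any? (λ u → T? (t u v) ×-dec reach? (pred (depth v)) u))

  parent-spec : ∀ v → v ≢ r → Adj t (parent v) v × depth (parent v) < depth v
  parent-spec v v≢r = from-layer (subst (λ k → Reach k v) depth≡1+d (depth-reach v))
    where
    d = pred (depth v)
    depth≡1+d : depth v ≡ suc d
    depth≡1+d with depth v | depth-reach v
    ... | zero  | v≡r = ⊥-elim (v≢r v≡r)
    ... | suc _ | _   = refl
    from-layer : Reach (suc d) v → Adj t (parent v) v × depth (parent v) < depth v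
    from-layer (inj₁ reach-d) = ⊥-elim (<-irrefl depth≡1+d (s≤s (depth-least v reach-d)))
    from-layer (inj₂ via) with choice-satisfies r (any? (λ u → T? (t u v) ×-dec reach? d u)) via
    ... | u-v , reach-u = u-v , subst (depth (parent v) <_) (sym depth≡1+d) (s≤s (depth-least (parent v) reach-u))

  rooting : Rooting r
  rooting = record { parent = parent ; rank = depth ; rank-parent = λ v v≢r → proj₂ (parent-spec v v≢r) }

-- Re-hanging a rooted tree on module representatives

module Rehang {n k : ℕ} (G : Graph n) (p : Fin n → Fin (suc k)) (r : Fin n)
              (only-r : ∀ v → p v ≡ zero → v ≡ r) (p-r : p r ≡ zero)
              (modules : ∀ i → IsModule G (InPart p i))
              (R₀ : Rooting r)
              (parent-adj : ∀ x → x ≢ r → T (adj G x (Rooting.parent R₀ x)))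
              (no-single-child : ∀ y → y ≢ r → ParentTree.children R₀ y ≢ 1)
              (root-children≢1 : ParentTree.children R₀ r ≢ 1)
              (root-children≢2 : ParentTree.children R₀ r ≢ 2) where

  open Rooting R₀ renaming (rank to depth; rank-parent to depth-parent)
  open ParentTree R₀

  nonroot-part : ∀ {x} → x ≢ r → p x ≢ zero
  nonroot-part x≢r = x≢r ∘ only-r _

  adj-sym : ∀ {x y} → T (adj G x y) → T (adj G y x)
  adj-sym {x} {y} = subst T (Graph.sym G x y)

  module-adj : ∀ {i x y z} → p x ≢ i → p y ≡ i → p z ≡ i → T (adj G x y) → T (adj G x z)
  module-adj {i} {x} {y} {z} x∉ y∈ z∈ = subst T (modules i x x∉ y z y∈ z∈)

  Internal : Fin n → Set
  Internal y = ∃[ x ] ChildOf x y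

  InternalIn : Fin (suc k) → Fin n → Set
  InternalIn l y = p y ≡ l × Internal y

  internalIn? : ∀ l y → Dec (InternalIn l y)
  internalIn? l y = (p y ≟ l) ×-dec any? (λ x → childOf? x y)

  children≥2 : ∀ {y} → y ≢ r → Internal y → 2 ≤ children y
  children≥2 {y} y≢r (x , x↑) = at-least-two (count-positive (λ x → childOf? x y) x x↑) (no-single-child y y≢r)
    where
    at-least-two : ∀ {c} → 0 < c → c ≢ 1 → 2 ≤ c
    at-least-two {suc zero}    _ c≢1 = ⊥-elim (c≢1 refl)
    at-least-two {suc (suc _)} _ _   = s≤s (s≤s z≤n)

  opaque
    rep : Fin (suc k) → Fin n
    rep l = argminOr (internalIn? l) depth r

    rep-minimal : ∀ {l y} → InternalIn l y → InternalIn l (rep l) × depth (rep l) ≤ depth y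
    rep-minimal {l} {y} = argminOr-minimal (internalIn? l) depth r y

    rep-cases : ∀ l → InternalIn l (rep l) ⊎ rep l ≡ r
    rep-cases l = argminOr-cases (internalIn? l) depth r

  rep-zero : rep zero ≡ r
  rep-zero = [ only-r _ ∘ proj₁ , id ]′ (rep-cases zero)

  rep-idem : ∀ l → rep (p (rep l)) ≡ rep l
  rep-idem l with rep-cases l
  ... | inj₁ (p≡l , _) = cong rep p≡l
  ... | inj₂ rep≡r     = trans (cong (rep ∘ p) rep≡r) (trans (cong rep p-r) (trans rep-zero (sym rep≡r)))

  rep-internalIn : ∀ {l} → rep l ≢ r → InternalIn l (rep l)
  rep-internalIn {l} rep≢r = [ id , ⊥-elim ∘ rep≢r ]′ (rep-cases l)

  rep-injective : ∀ {u w} → rep u ≢ r → rep w ≡ rep u → w ≡ u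
  rep-injective {u} {w} rep≢r same = begin
    w          ≡⟨ sym (proj₁ (rep-internalIn (rep≢r ∘ trans (sym same)))) ⟩
    p (rep w)  ≡⟨ cong p same ⟩
    p (rep u)  ≡⟨ proj₁ (rep-internalIn rep≢r) ⟩
    u          ∎
    where open ≡-Reasoning

  rep-nonroot : ∀ {l y} → InternalIn l y → l ≢ zero → rep l ≢ r
  rep-nonroot y∈l l≢0 rep≡r = l≢0 (trans (sym (proj₁ (proj₁ (rep-minimal y∈l)))) (trans (cong p rep≡r) p-r))

  parent-internal : ∀ {x} → x ≢ r → InternalIn (p (parent x)) (parent x)
  parent-internal x≢r = refl , _ , x≢r , refl

  Inner : Fin n → Set
  Inner x = p (parent x) ≡ p x

  rep-not-inner : ∀ {y} → y ≢ r → rep (p y) ≡ y → ¬ Inner y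
  rep-not-inner {y} y≢r rep≡y inner = <-irrefl (cong depth rep≡y) (≤-<-trans rep≤parent (depth-parent y y≢r))
    where
    rep≤parent : depth (rep (p y)) ≤ depth (parent y)
    rep≤parent = subst (λ l → depth (rep l) ≤ depth (parent y)) inner (proj₂ (rep-minimal (parent-internal y≢r)))

  up : Fin (suc k) → Fin (suc k)
  up l = p (parent (rep l))

  up-≢ : ∀ {l} → rep l ≢ r → up l ≢ l
  up-≢ {l} rep≢r = subst (up l ≢_) (proj₁ (rep-internalIn rep≢r)) (rep-not-inner rep≢r (rep-idem l))

  inner-rep-nonroot : ∀ {x} → x ≢ r → Inner x → rep (p x) ≢ r
  inner-rep-nonroot {x} x≢r inner =
    rep-nonroot (subst (λ l → InternalIn l (parent x)) inner (parent-internal x≢r)) (nonroot-part x≢r)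

  inner-rep-deeper : ∀ {x} → x ≢ r → Inner x → depth (rep (up (p x))) < depth (rep (p x))
  inner-rep-deeper x≢r inner = ≤-<-trans (proj₂ (rep-minimal (parent-internal R≢r))) (depth-parent _ R≢r)
    where R≢r = inner-rep-nonroot x≢r inner

  ChosenFor : Fin (suc k) → Fin n → Set
  ChosenFor l x = ChildOf x (rep l) × p x ≡ l

  chosenFor? : ∀ l x → Dec (ChosenFor l x)
  chosenFor? l x = childOf? x (rep l) ×-dec (p x ≟ l)

  opaque
    chosen : Fin (suc k) → Fin n
    chosen l = choice r (any? (chosenFor? l))

    chosen-spec : ∀ {l} → ∃ (ChosenFor l) → ChosenFor l (chosen l)
    chosen-spec {l} = choice-satisfies r (any? (chosenFor? l))

  module Hanging (keep : Fin (suc k) → Bool) where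

    Kept : Fin n → Set
    Kept x = x ≡ chosen (p x) × T (keep (p x))

    kept? : ∀ x → Dec (Kept x)
    kept? x = (x ≟ chosen (p x)) ×-dec T? (keep (p x))

    KeptAt OuterAt LiftedAt : Fin (suc k) → Fin n → Set
    KeptAt   u x = x ≢ r × Inner x × Kept x × p x ≡ u
    OuterAt  u x = x ≢ r × ¬ Inner x × p (parent x) ≡ u
    LiftedAt u x = x ≢ r × Inner x × ¬ Kept x × up (p x) ≡ u

    keptAt? : ∀ u x → Dec (KeptAt u x)
    keptAt? u x = ¬? (x ≟ r) ×-dec (p (parent x) ≟ p x) ×-dec kept? x ×-dec (p x ≟ u)

    outerAt? : ∀ u x → Dec (OuterAt u x)
    outerAt? u x = ¬? (x ≟ r) ×-dec ¬? (p (parent x) ≟ p x) ×-dec (p (parent x) ≟ u)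

    liftedAt? : ∀ u x → Dec (LiftedAt u x)
    liftedAt? u x = ¬? (x ≟ r) ×-dec (p (parent x) ≟ p x) ×-dec ¬? (kept? x) ×-dec (up (p x) ≟ u)

    incoming? : ∀ u x → Dec (OuterAt u x ⊎ LiftedAt u x)
    incoming? u x = outerAt? u x ⊎-dec liftedAt? u x

    incoming : Fin (suc k) → ℕ
    incoming u = count (incoming? u)

  keep-rule : (Fin (suc k) → Bool) → Fin (suc k) → Bool
  keep-rule keep u = does (Hanging.incoming keep u ≟ℕ 1)

  keep-rule-local : ∀ f g u → (∀ l → depth (rep u) < depth (rep l) → f l ≡ g l) →
                    keep-rule f u ≡ keep-rule g u
  keep-rule-local f g u agree =
    cong (λ m → does (m ≟ℕ 1))
         (count-cong (Hanging.incoming? f u) (Hanging.incoming? g u) λ x →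
            mk⇔ (transfer agree) (transfer (λ l lt → sym (agree l lt))))
    where
    transfer : ∀ {f g x} → (∀ l → depth (rep u) < depth (rep l) → f l ≡ g l) →
               Hanging.OuterAt f u x ⊎ Hanging.LiftedAt f u x → Hanging.OuterAt g u x ⊎ Hanging.LiftedAt g u x
    transfer _     (inj₁ outer) = inj₁ outer
    transfer agree (inj₂ (x≢r , inner , ¬kept , up≡u)) =
      inj₂ (x≢r , inner , (λ (x≡c , kept) → ¬kept (x≡c , subst T (sym (agree _ deeper)) kept)) , up≡u)
      where deeper = subst (λ l → depth (rep l) < _) up≡u (inner-rep-deeper x≢r inner)

  opaque
    keep : Fin (suc k) → Bool
    keep = fixpoint keep-rule (depth ∘ rep) keep-rule-local (λ _ → false)

    keep-unfold : ∀ u → keep u ≡ keep-rule keep u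
    keep-unfold = fixpoint-unfold keep-rule (depth ∘ rep) keep-rule-local (λ _ → false)

  open Hanging keep

  keep⇔ : ∀ u → T (keep u) ⇔ incoming u ≡ 1
  keep⇔ u = subst (λ b → T b ⇔ incoming u ≡ 1) (sym (keep-unfold u)) (T-does (incoming u ≟ℕ 1))

  target : Fin n → Fin (suc k)
  target x with p (parent x) ≟ p x | kept? x
  ... | no _  | _     = p (parent x)
  ... | yes _ | yes _ = p x
  ... | yes _ | no _  = up (p x)

  target-spec : ∀ {x} u → x ≢ r → target x ≡ u ⇔ (KeptAt u x ⊎ OuterAt u x ⊎ LiftedAt u x)
  target-spec {x} u x≢r with p (parent x) ≟ p x | kept? x
  ... | no outer | _ = mk⇔ (λ e → inj₂ (inj₁ (x≢r , outer , e))) λ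
    { (inj₁ (_ , inner , _))         → ⊥-elim (outer inner)
    ; (inj₂ (inj₁ (_ , _ , e)))      → e
    ; (inj₂ (inj₂ (_ , inner , _)))  → ⊥-elim (outer inner)
    }
  ... | yes inner | yes kept = mk⇔ (λ e → inj₁ (x≢r , inner , kept , e)) λ
    { (inj₁ (_ , _ , _ , e))             → e
    ; (inj₂ (inj₁ (_ , outer , _)))      → ⊥-elim (outer inner)
    ; (inj₂ (inj₂ (_ , _ , ¬kept , _)))  → ⊥-elim (¬kept kept)
    }
  ... | yes inner | no ¬kept = mk⇔ (λ e → inj₂ (inj₂ (x≢r , inner , ¬kept , e))) λ
    { (inj₁ (_ , _ , kept , _))          → ⊥-elim (¬kept kept)
    ; (inj₂ (inj₁ (_ , outer , _)))      → ⊥-elim (outer inner)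
    ; (inj₂ (inj₂ (_ , _ , _ , e)))      → e
    }

  target-cases : ∀ {x} → x ≢ r → KeptAt (target x) x ⊎ OuterAt (target x) x ⊎ LiftedAt (target x) x
  target-cases x≢r = Equivalence.to (target-spec _ x≢r) refl

  parent₁ : Fin n → Fin n
  parent₁ x = rep (target x)

  -- Only representatives receive children, so any rank above that of its parent does for a
  -- vertex that is not one.
  rank₁ : Fin n → ℕ
  rank₁ x = if does (rep (p x) ≟ x) then depth x else suc (depth (parent₁ x))

  rep-parent₁ : ∀ {y} → y ≢ r → rep (p y) ≡ y → parent₁ y ≡ rep (p (parent y))
  rep-parent₁ y≢r is-rep =
    cong rep (Equivalence.from (target-spec _ y≢r) (inj₂ (inj₁ (y≢r , rep-not-inner y≢r is-rep , refl))))

  rank₁-rep : ∀ l → rank₁ (rep l) ≡ depth (rep l)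
  rank₁-rep l with rep (p (rep l)) ≟ rep l
  ... | yes _      = refl
  ... | no not-rep = ⊥-elim (not-rep (rep-idem l))

  rank₁-parent : ∀ x → x ≢ r → rank₁ (parent₁ x) < rank₁ x
  rank₁-parent x x≢r rewrite rank₁-rep (target x) with rep (p x) ≟ x
  ... | no _       = n<1+n _
  ... | yes is-rep = subst (λ y → depth y < depth x) (sym (rep-parent₁ x≢r is-rep))
                           (≤-<-trans (proj₂ (rep-minimal (parent-internal x≢r))) (depth-parent x x≢r))

  R₁ : Rooting r
  R₁ = record { parent = parent₁ ; rank = rank₁ ; rank-parent = rank₁-parent }

  module New = ParentTree R₁

  chosen-valid : ∀ {l} → T (keep l) → rep l ≢ r → ChosenFor l (chosen l)
  chosen-valid {l} kept R≢r = chosen-spec (count-witness (chosenFor? l) (positive split 2≤children outside≤1))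
    where
    R = rep l
    outside? : ∀ x → Dec (ChildOf x R × p x ≢ l)
    outside? x = childOf? x R ×-dec ¬? (p x ≟ l)
    split = count-split (λ x → childOf? x R) (λ x → p x ≟ l)
    2≤children = children≥2 R≢r (proj₂ (rep-internalIn R≢r))
    outside→outer : ∀ x → ChildOf x R × p x ≢ l → OuterAt l x ⊎ LiftedAt l x
    outside→outer x ((x≢r , px≡R) , px≢l) =
      inj₁ (x≢r , (λ inner → px≢l (trans (sym inner) ppx≡l)) , ppx≡l)
      where ppx≡l = trans (cong p px≡R) (proj₁ (rep-internalIn R≢r))
    outside≤1 : count outside? ≤ 1
    outside≤1 = subst (count outside? ≤_) (Equivalence.to (keep⇔ l) kept)
                      (count-mono outside? (incoming? l) outside→outer)
    positive : ∀ {a b c} → c ≡ a + b → 2 ≤ c → b ≤ 1 → 0 < a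
    positive {zero}  refl 2≤b b≤1 = ⊥-elim (2≰1 (≤-trans 2≤b b≤1))
      where
      2≰1 : ¬ (2 ≤ 1)
      2≰1 (s≤s ())
    positive {suc _} _ _ _ = s≤s z≤n

  parent₁-adj : ∀ x → x ≢ r → T (adj G x (parent₁ x))
  parent₁-adj x x≢r with target-cases x≢r
  ... | inj₁ (_ , inner , (x≡c , kept) , px≡t) = subst (λ y → T (adj G x y)) parent≡ (parent-adj x x≢r)
    where
    parent≡ : parent x ≡ rep (target x)
    parent≡ = begin
      parent x               ≡⟨ cong parent x≡c ⟩
      parent (chosen (p x))  ≡⟨ proj₂ (proj₁ (chosen-valid kept (inner-rep-nonroot x≢r inner))) ⟩
      rep (p x)              ≡⟨ cong rep px≡t ⟩
      rep (target x)         ∎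
      where open ≡-Reasoning
  ... | inj₂ (inj₁ (_ , outer , ppx≡t)) = module-adj (outer ∘ trans ppx≡t ∘ sym) ppx≡t rep∈ (parent-adj x x≢r)
    where rep∈ = proj₁ (proj₁ (rep-minimal (subst (λ l → InternalIn l (parent x)) ppx≡t (parent-internal x≢r))))
  ... | inj₂ (inj₂ (_ , inner , _ , up≡t)) = module-adj (up-≢ R≢r ∘ trans up≡t ∘ sym) up≡t rep∈ x~parent-R
    where
    R≢r = inner-rep-nonroot x≢r inner
    R = rep (p x)
    rep∈ = proj₁ (proj₁ (rep-minimal (subst (λ l → InternalIn l (parent R)) up≡t (parent-internal R≢r))))
    x~parent-R : T (adj G x (parent R))
    x~parent-R = adj-sym (module-adj (up-≢ R≢r) (proj₁ (rep-internalIn R≢r)) refl (adj-sym (parent-adj R R≢r)))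

  new-children-rep : ∀ {u} → rep u ≢ r → New.children (rep u) ≡ count (keptAt? u) + incoming u
  new-children-rep {u} R≢r =
    trans (count-cong (λ x → New.childOf? x (rep u)) (λ x → keptAt? u x ⊎-dec incoming? u x) classes)
          (count-⊎ (keptAt? u) (incoming? u) disjoint)
    where
    classes : ∀ x → New.ChildOf x (rep u) ⇔ (KeptAt u x ⊎ OuterAt u x ⊎ LiftedAt u x)
    classes x = mk⇔ (λ (x≢r , same) → Equivalence.to (target-spec u x≢r) (rep-injective R≢r same)) λ c →
      let x≢r = [ proj₁ , [ proj₁ , proj₁ ]′ ]′ c in x≢r , cong rep (Equivalence.from (target-spec u x≢r) c)
    disjoint : ∀ x → KeptAt u x → ¬ (OuterAt u x ⊎ LiftedAt u x)
    disjoint x (_ , inner , _)    (inj₁ (_ , outer , _))     = outer inner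
    disjoint x (_ , _ , kept , _) (inj₂ (_ , _ , ¬kept , _)) = ¬kept kept

  kept-count-keep : ∀ {u} → T (keep u) → rep u ≢ r → count (keptAt? u) ≡ 1
  kept-count-keep {u} kept R≢r =
    count-unique (keptAt? u) c (c≢r , inner , (cong chosen (sym pc≡u) , subst (T ∘ keep) (sym pc≡u) kept) , pc≡u)
                 λ x (_ , _ , (x≡c , _) , px≡u) → trans x≡c (cong chosen px≡u)
    where
    c = chosen u
    valid = chosen-valid kept R≢r
    c≢r = proj₁ (proj₁ valid)
    pc≡u = proj₂ valid
    inner : Inner c
    inner = trans (cong p (proj₂ (proj₁ valid))) (trans (proj₁ (rep-internalIn R≢r)) (sym pc≡u))

  kept-count-drop : ∀ {u} → ¬ T (keep u) → count (keptAt? u) ≡ 0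
  kept-count-drop {u} dropped =
    count-none (keptAt? u) λ x (_ , _ , (_ , kept) , px≡u) → dropped (subst (T ∘ keep) px≡u kept)

  new-degIn-rep : ∀ {u} → rep u ≢ r → degIn New.tree p u (rep u) ≡ count (keptAt? u)
  new-degIn-rep {u} R≢r =
    trans (New.degIn-tree p u R parent-outside)
          (count-cong (λ x → New.childOf? x R ×-dec (p x ≟ u)) (keptAt? u) same-part)
    where
    R = rep u
    pR≡u = proj₁ (rep-internalIn R≢r)
    parent-outside : p (parent₁ R) ≢ u
    parent-outside e = rep-not-inner R≢r (rep-idem u) (begin
      p (parent R)             ≡⟨ sym (proj₁ (proj₁ (rep-minimal (parent-internal R≢r)))) ⟩
      p (rep (p (parent R)))   ≡⟨ cong p (sym (rep-parent₁ R≢r (rep-idem u))) ⟩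
      p (parent₁ R)            ≡⟨ trans e (sym pR≡u) ⟩
      p R                      ∎)
      where open ≡-Reasoning
    same-part : ∀ x → (New.ChildOf x R × p x ≡ u) ⇔ KeptAt u x
    same-part x = mk⇔ to λ c@(x≢r , _ , _ , px≡u) →
      (x≢r , cong rep (Equivalence.from (target-spec u x≢r) (inj₁ c))) , px≡u
      where
      to : New.ChildOf x R × p x ≡ u → KeptAt u x
      to ((x≢r , same) , px≡u) with Equivalence.to (target-spec u x≢r) (rep-injective R≢r same)
      ... | inj₁ kept-here                      = kept-here
      ... | inj₂ (inj₁ (_ , outer , ppx≡u))     = ⊥-elim (outer (trans ppx≡u (sym px≡u)))
      ... | inj₂ (inj₂ (_ , inner , _ , up≡u)) =
        ⊥-elim (up-≢ (inner-rep-nonroot x≢r inner) (trans up≡u (sym px≡u)))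

  RepShape : Fin (suc k) → Fin n → Set
  RepShape u y = deg New.tree y ≡ 1
               ⊎ (deg New.tree y ≡ 3 × degIn New.tree p u y ≡ 1)
               ⊎ (3 ≤ deg New.tree y × degIn New.tree p u y ≡ 0)

  rep-shape : ∀ u → rep u ≢ r → RepShape u (rep u)
  rep-shape u R≢r with T? (keep u)
  ... | yes kept = inj₂ (inj₁ (deg≡3 , trans (new-degIn-rep R≢r) (kept-count-keep kept R≢r)))
    where
    deg≡3 : deg New.tree (rep u) ≡ 3
    deg≡3 = begin
      deg New.tree (rep u)                  ≡⟨ New.deg-tree-nonroot (rep u) R≢r ⟩
      suc (New.children (rep u))            ≡⟨ cong suc (new-children-rep R≢r) ⟩
      suc (count (keptAt? u) + incoming u)  ≡⟨ cong₂ (λ a b → suc (a + b)) (kept-count-keep kept R≢r)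
                                                                          (Equivalence.to (keep⇔ u) kept) ⟩
      3                                     ∎
      where open ≡-Reasoning
  ... | no dropped = by-incoming (incoming u) deg≡ (dropped ∘ Equivalence.from (keep⇔ u))
    where
    deg≡ : deg New.tree (rep u) ≡ suc (incoming u)
    deg≡ = trans (New.deg-tree-nonroot (rep u) R≢r)
                 (cong suc (trans (new-children-rep R≢r) (cong (_+ incoming u) (kept-count-drop dropped))))
    degIn≡0 = trans (new-degIn-rep R≢r) (kept-count-drop dropped)
    by-incoming : ∀ m → deg New.tree (rep u) ≡ suc m → m ≢ 1 → RepShape u (rep u)
    by-incoming zero          d _   = inj₁ d
    by-incoming (suc zero)    _ m≢1 = ⊥-elim (m≢1 refl)
    by-incoming (suc (suc _)) d _   = inj₂ (inj₂ (subst (3 ≤_) (sym d) (s≤s (s≤s (s≤s z≤n))) , degIn≡0))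

  nonrep-leaf : ∀ y → rep (p y) ≢ y → deg New.tree y ≡ 1
  nonrep-leaf y not-rep = trans (New.deg-tree-nonroot y y≢r) (cong suc (count-none (λ x → New.childOf? x y) no-child))
    where
    y≢r : y ≢ r
    y≢r refl = not-rep (trans (cong rep p-r) rep-zero)
    no-child : ∀ x → ¬ New.ChildOf x y
    no-child x (_ , refl) = not-rep (rep-idem (target x))

  new-root-children≢2 : New.children r ≢ 2
  new-root-children≢2 = by-children (children r) refl
    where
    child→child : ∀ x → ChildOf x r → New.ChildOf x r
    child→child x (x≢r , px≡r) = x≢r , (begin
      rep (target x)      ≡⟨ cong rep (Equivalence.from (target-spec _ x≢r) (inj₂ (inj₁ (x≢r , outer , refl)))) ⟩
      rep (p (parent x))  ≡⟨ cong (rep ∘ p) px≡r ⟩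
      rep (p r)           ≡⟨ cong rep p-r ⟩
      rep zero            ≡⟨ rep-zero ⟩
      r                   ∎)
      where
      open ≡-Reasoning
      outer : ¬ Inner x
      outer inner = nonroot-part x≢r (trans (sym inner) (trans (cong p px≡r) p-r))
    more-children : children r ≤ New.children r
    more-children = count-mono (λ x → childOf? x r) (λ x → New.childOf? x r) child→child
    by-children : ∀ m → children r ≡ m → New.children r ≢ 2
    by-children zero c≡0 c₁≡2 = 0≢2 (trans (sym (count-none (λ x → New.childOf? x r) no-child)) c₁≡2)
      where
      0≢2 : 0 ≢ 2
      0≢2 ()
      no-child : ∀ x → ¬ New.ChildOf x r
      no-child x (x≢r , _) with root-has-child x x≢r
      ... | y , y↑ = <-irrefl (sym c≡0) (count-positive (λ x → childOf? x r) y y↑)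
    by-children (suc zero)          c≡1 = ⊥-elim (root-children≢1 c≡1)
    by-children (suc (suc zero))    c≡2 = ⊥-elim (root-children≢2 c≡2)
    by-children (suc (suc (suc m))) c≡3+m c₁≡2 =
      3+m≰2 (subst (3 + m ≤_) c₁≡2 (subst (_≤ New.children r) c≡3+m more-children))
      where
      3+m≰2 : ¬ (3 + m ≤ 2)
      3+m≰2 (s≤s (s≤s ()))

  new-HIST : HIST G New.tree
  new-HIST = record { tree = New.tree-spanning G parent₁-adj ; no2 = no-deg-2 }
    where
    shape≢2 : ∀ {u y} → RepShape u y → deg New.tree y ≢ 2
    shape≢2 (inj₁ d≡1)              d≡2 = 1≢2 (trans (sym d≡1) d≡2)
      where
      1≢2 : 1 ≢ 2
      1≢2 ()
    shape≢2 (inj₂ (inj₁ (d≡3 , _))) d≡2 = 3≢2 (trans (sym d≡3) d≡2)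
      where
      3≢2 : 3 ≢ 2
      3≢2 ()
    shape≢2 (inj₂ (inj₂ (3≤d , _))) d≡2 = 3≰2 (subst (3 ≤_) d≡2 3≤d)
      where
      3≰2 : ¬ (3 ≤ 2)
      3≰2 (s≤s (s≤s ()))
    no-deg-2 : ∀ v → deg New.tree v ≢ 2
    no-deg-2 v = by-cases (v ≟ r) (rep (p v) ≟ v)
      where
      by-cases : Dec (v ≡ r) → Dec (rep (p v) ≡ v) → deg New.tree v ≢ 2
      by-cases (yes v≡r) _            =
        subst (λ y → deg New.tree y ≢ 2) (sym v≡r) (new-root-children≢2 ∘ trans (sym New.deg-tree-root))
      by-cases (no v≢r)  (no not-rep) = shape≢2 {zero} (inj₁ (nonrep-leaf v not-rep))
      by-cases (no v≢r)  (yes is-rep) =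
        subst (λ y → deg New.tree y ≢ 2) is-rep (shape≢2 (rep-shape (p v) (v≢r ∘ trans (sym is-rep))))

  new-good : ∀ i → GoodPart New.tree p (suc i)
  new-good i = by-rep (rep (suc i) ≟ r)
    where
    R = rep (suc i)
    others : ∀ v → InPart p (suc i) v → v ≢ R → deg New.tree v ≡ 1
    others v v∈ v≢R = nonrep-leaf v λ is-rep → v≢R (trans (sym is-rep) (cong rep v∈))
    by-shape : R ≢ r → RepShape (suc i) R → GoodPart New.tree p (suc i)
    by-shape _   (inj₁ d≡1)              =
      inj₁ λ v v∈ → [ (λ { refl → d≡1 }) , others v v∈ ]′ (Dec.toSum (v ≟ R))
    by-shape R≢r (inj₂ (inj₁ (d≡3 , di))) =
      inj₂ (R , proj₁ (rep-internalIn R≢r) , ≤-reflexive (sym d≡3) , others , inj₁ (d≡3 , di))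
    by-shape R≢r (inj₂ (inj₂ (3≤d , di))) =
      inj₂ (R , proj₁ (rep-internalIn R≢r) , 3≤d , others , inj₂ (3≤d , di))
    by-rep : Dec (R ≡ r) → GoodPart New.tree p (suc i)
    by-rep (yes R≡r) = inj₁ λ v v∈ → nonrep-leaf v λ is-rep →
      0≢1+n (trans (sym (trans (cong p (trans (sym is-rep) (trans (cong rep v∈) R≡r))) p-r)) v∈)
    by-rep (no R≢r)  = by-shape R≢r (rep-shape (suc i) R≢r)

lemma4 : ∀ {n k} (G : Graph n) (p : Fin n → Fin (1+ k)) (r : Fin n) →
    (∀ v → p v ≡ zero → v ≡ r) → p r ≡ zero →
    (∀ i → IsModule G (InPart p i)) →
    Σ (EdgeSet n) (λ t → HIST G t × deg t r ≢ 1) →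
    Σ (EdgeSet n) (λ t → HIST G t × (∀ (i : Fin k) → GoodPart t p (suc i)))
lemma4 G p r only-r p-r modules (t , hist , root-not-leaf) = New.tree , new-HIST , new-good
  where
  open HIST hist
  open SpanningTree tree
  module BFS = BreadthFirst t r (conn r)
  module Old = ParentTree BFS.rooting

  parent-edge : ∀ x → x ≢ r → Adj t x (BFS.parent x)
  parent-edge x x≢r = subst T (tsym _ x) (proj₁ (BFS.parent-spec x x≢r))

  parent-adj : ∀ x → x ≢ r → T (adj G x (BFS.parent x))
  parent-adj x x≢r = sub x _ (parent-edge x x≢r)

  deg-old : ∀ v → deg t v ≡ deg Old.tree v
  deg-old = Old.deg-spanning-tree tree parent-edge

  no-single-child : ∀ y → y ≢ r → Old.children y ≢ 1
  no-single-child y y≢r c≡1 = no2 y (trans (deg-old y) (trans (Old.deg-tree-nonroot y y≢r) (cong 1+ c≡1)))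

  root-deg : deg t r ≡ Old.children r
  root-deg = trans (deg-old r) Old.deg-tree-root

  open Rehang G p r only-r p-r modules BFS.rooting parent-adj no-single-child
              (root-not-leaf ∘ trans root-deg) (no2 r ∘ trans root-deg)
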